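{- Let $h$ be a height function and $\mathcal{G}$ its crosses-and-wrenches graph with edge labels $\lambda$. Then the map $e\mapsto\lambda(e)$ from the set $E_w$ of weighted edges of $\mathcal{G}$ to the set of edge variables is injective: no two distinct weighted edges receive the same label.
   Context: A height function is $h\colon\mathbb{Z}^2\to\mathbb{Z}$ with $|h(i_1,j_1)-h(i_2,j_2)|=1$ whenever $|i_1-i_2|+|j_1-j_2|=1$ (lattice-adjacent), $h(i,j)\equiv i+j\pmod 2$, and $h(i,j)+|i|+|j|\to\infty$ as $|i|+|j|\to\infty$. The crosses-and-wrenches graph $\mathcal{G}$ of $h$ is a planar graph with one face for each $(i,j)\in\mathbb{Z}^2$; its weighted edges are in bijection with unordered pairs of lattice-adjacent faces, the weighted edge for such a pair being the edge separating those two faces (the other edges of $\mathcal{G}$ are unweighted and play no role here). Edge labels: for the weighted edge $e$ separating faces $(i_1,j_1)$ and $(i_2,j_2)$ with $(i_1-i_2)+(j_1-j_2)=1$, put $n_k=h(i_k,j_k)$. If $i_1=i_2+1$: $\lambda(e)=a(i_1+n_2,j_1)$ when $n_1>n_2$ and $\lambda(e)=c(i_1-n_2,j_1)$ when $n_1<n_2$. If $j_1=j_2+1$: $\lambda(e)=b(i_1,j_1+n_2)$ when $n_1>n_2$ and $\lambda(e)=d(i_1,j_1-n_2)$ when $n_1<n_2$. Here $a(\cdot,\cdot),b(\cdot,\cdot),c(\cdot,\cdot),d(\cdot,\cdot)$ are distinct formal symbols indexed by $\mathbb{Z}^2$. -}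

module Defs where

open import Data.Nat using (ℕ)
import Data.Nat as ℕ
open import Data.Integer using (ℤ; +_; _+_; _-_; ∣_∣; _≤_; _<?_)
open import Data.Integer.Divisibility using (_∣_)
open import Data.Product using (_×_; _,_; ∃)
open import Relation.Binary.PropositionalEquality using (_≡_)
open import Relation.Nullary using (yes; no)

record HeightFunction : Set where
  field
    h : ℤ → ℤ → ℤ
    adjᵢ : ∀ i j → ∣ h (i + + 1) j - h i j ∣ ≡ 1
    adjⱼ : ∀ i j → ∣ h i (j + + 1) - h i j ∣ ≡ 1
    parity : ∀ i j → + 2 ∣ (h i j - (i + j))
    growth : ∀ (M : ℤ) → ∃ λ (N : ℕ) → ∀ i j →
      N ℕ.≤ ∣ i ∣ ℕ.+ ∣ j ∣ → M ≤ h i j + + ∣ i ∣ + + ∣ j ∣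

-- Direction of a weighted edge: the two faces differ in i (horiz) or j (vert).
data Dir : Set where
  horiz vert : Dir

-- Weighted edges ↔ unordered pairs of lattice-adjacent faces.
-- Each such pair is uniquely written as {(i₁,j₁),(i₂,j₂)} with
-- (i₁-i₂)+(j₁-j₂) = 1, i.e. (i₁,j₁) = (i₂,j₂) + unit step in direction d.
-- We record the edge by the "lower" face (i₂,j₂) and the direction d.
record WEdge : Set where
  constructor wedge
  field
    i₂ j₂ : ℤ
    dir   : Dir

data EdgeVar : Set where
  a b c d : ℤ → ℤ → EdgeVar

label : HeightFunction → WEdge → EdgeVar
label H (wedge i₂ j₂ horiz) with n₂ <? n₁
  where
    open HeightFunction H
    n₁ = h (i₂ + + 1) j₂
    n₂ = h i₂ j₂
... | yes _ = a (i₂ + + 1 + HeightFunction.h H i₂ j₂) j₂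
... | no  _ = c (i₂ + + 1 - HeightFunction.h H i₂ j₂) j₂
label H (wedge i₂ j₂ vert) with n₂ <? n₁
  where
    open HeightFunction H
    n₁ = h i₂ (j₂ + + 1)
    n₂ = h i₂ j₂
... | yes _ = b i₂ (j₂ + + 1 + HeightFunction.h H i₂ j₂)
... | no  _ = d i₂ (j₂ + + 1 - HeightFunction.h H i₂ j₂)

{-# OPTIONS --safe #-}
-- Along a row j the heights u k = h k j move by ±1, so the index k + 1 + u k of an a-label is
-- nondecreasing in k and jumps (by 2) exactly where u ascends; hence distinct ascending edges of
-- a row get distinct a-labels. The c-labels k + 1 - u k of the descending edges are the a-indices
-- of -u, columns are handled the same way with b and d, and the letter of a label records whether
-- the edge is horizontal.
module Submission where

open import Defs
open import Data.Integer
  using (ℤ; +_; -[1+_]; 1ℤ; -1ℤ; _+_; _-_; -_; ∣_∣; _≤_; _<_; _<?_; Positive)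
open import Data.Integer.Properties
open import Data.Integer.Tactic.RingSolver using (solve-∀)
open import Data.Nat using (zero; suc)
open import Data.Sum using (_⊎_; inj₁; inj₂)
open import Relation.Binary.Definitions using (tri<; tri≈; tri>)
open import Relation.Binary.PropositionalEquality
  using (_≡_; refl; sym; trans; cong; subst; module ≡-Reasoning)
open import Relation.Nullary using (¬_; yes; no; contradiction)

i<i+j : ∀ i j .{{_ : Positive j}} → i < i + j
i<i+j i j = subst (_< i + j) (+-identityʳ i) (+-monoʳ-< i (positive⁻¹ j))

j≡i+[j-i] : ∀ i j → j ≡ i + (j - i)
j≡i+[j-i] = solve-∀

i≤j⇒j≡i+∣j-i∣ : ∀ {i j} → i ≤ j → j ≡ i + + ∣ j - i ∣
i≤j⇒j≡i+∣j-i∣ {i} {j} i≤j = begin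
  j                ≡⟨ j≡i+[j-i] i j ⟩
  i + (j - i)      ≡⟨ cong (λ x → i + x) (0≤i⇒+∣i∣≡i (i≤j⇒0≤j-i i≤j)) ⟨
  i + + ∣ j - i ∣  ∎
  where open ≡-Reasoning

StepwiseMonotone : (ℤ → ℤ) → Set
StepwiseMonotone f = ∀ k → f k ≤ f (k + 1ℤ)

Ascends : (ℤ → ℤ) → ℤ → Set
Ascends f k = f k < f (k + 1ℤ)

module _ {f : ℤ → ℤ} (mono : StepwiseMonotone f) where

  stepwiseMonotone-+ : ∀ k n → f k ≤ f (k + + n)
  stepwiseMonotone-+ k zero = ≤-reflexive (cong f (sym (+-identityʳ k)))
  stepwiseMonotone-+ k (suc n) = ≤-trans (mono k)
    (subst (λ l → f (k + 1ℤ) ≤ f l) (+-assoc k 1ℤ (+ n)) (stepwiseMonotone-+ (k + 1ℤ) n))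

  stepwiseMonotone⇒monotone : ∀ {k l} → k ≤ l → f k ≤ f l
  stepwiseMonotone⇒monotone {k} {l} k≤l =
    subst (λ m → f k ≤ f m) (sym (i≤j⇒j≡i+∣j-i∣ k≤l)) (stepwiseMonotone-+ k ∣ l - k ∣)

  ascends⇒<-later : ∀ {k l} → Ascends f k → k < l → f k < f l
  ascends⇒<-later {k} asc k<l = <-≤-trans asc
    (stepwiseMonotone⇒monotone (subst (_≤ _) (+-comm 1ℤ k) (i<j⇒suc[i]≤j k<l)))

  stepwiseMonotone-injective-on-ascents : ∀ {k l} → Ascends f k → Ascends f l → f k ≡ f l → k ≡ l
  stepwiseMonotone-injective-on-ascents {k} {l} asc-k asc-l fk≡fl with <-cmp k l
  ... | tri< k<l _ _ = contradiction fk≡fl (<⇒≢ (ascends⇒<-later asc-k k<l))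
  ... | tri≈ _ k≡l _ = k≡l
  ... | tri> _ _ l<k = contradiction (sym fk≡fl) (<⇒≢ (ascends⇒<-later asc-l l<k))

∣i∣≡1⇒i≡±1 : ∀ {i} → ∣ i ∣ ≡ 1 → i ≡ 1ℤ ⊎ i ≡ -1ℤ
∣i∣≡1⇒i≡±1 {+ zero}          ()
∣i∣≡1⇒i≡±1 {+ suc zero}      _  = inj₁ refl
∣i∣≡1⇒i≡±1 {+ suc (suc _)}   ()
∣i∣≡1⇒i≡±1 { -[1+ zero ]}    _  = inj₂ refl
∣i∣≡1⇒i≡±1 { -[1+ suc _ ]}   ()

UnitSteps : (ℤ → ℤ) → Set
UnitSteps u = ∀ k → ∣ u (k + 1ℤ) - u k ∣ ≡ 1

unitSteps-neg : ∀ {u} → UnitSteps u → UnitSteps (λ k → - u k)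
unitSteps-neg {u} unit k = begin
  ∣ - u (k + 1ℤ) - - u k ∣    ≡⟨ cong ∣_∣ (neg-distrib-+ (u (k + 1ℤ)) (- u k)) ⟨
  ∣ - (u (k + 1ℤ) - u k) ∣    ≡⟨ ∣-i∣≡∣i∣ (u (k + 1ℤ) - u k) ⟩
  ∣ u (k + 1ℤ) - u k ∣        ≡⟨ unit k ⟩
  1                          ∎
  where open ≡-Reasoning

unitStep : ∀ {u} → UnitSteps u → ∀ k → u (k + 1ℤ) ≡ u k + 1ℤ ⊎ u (k + 1ℤ) ≡ u k - 1ℤ
unitStep {u} unit k with ∣i∣≡1⇒i≡±1 (unit k)
... | inj₁ δ≡1  = inj₁ (trans (j≡i+[j-i] (u k) (u (k + 1ℤ))) (cong (λ δ → u k + δ) δ≡1))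
... | inj₂ δ≡-1 = inj₂ (trans (j≡i+[j-i] (u k) (u (k + 1ℤ))) (cong (λ δ → u k + δ) δ≡-1))

ascentIndex : (ℤ → ℤ) → ℤ → ℤ
ascentIndex u k = k + 1ℤ + u k

descentIndex : (ℤ → ℤ) → ℤ → ℤ
descentIndex u k = k + 1ℤ - u k

ascentIndex-suc : ∀ {u k s} → u (k + 1ℤ) ≡ u k + s →
                  ascentIndex u (k + 1ℤ) ≡ ascentIndex u k + (1ℤ + s)
ascentIndex-suc {u} {k} {s} step =
  trans (cong (λ x → k + 1ℤ + 1ℤ + x) step) (shift k (u k) s)
  where
  shift : ∀ k x s → k + 1ℤ + 1ℤ + (x + s) ≡ k + 1ℤ + x + (1ℤ + s)
  shift = solve-∀

module _ {u : ℤ → ℤ} (unit : UnitSteps u) where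

  ascentIndex-stepwiseMonotone : StepwiseMonotone (ascentIndex u)
  ascentIndex-stepwiseMonotone k with unitStep {u} unit k
  ... | inj₁ up   = subst (ascentIndex u k ≤_) (sym (ascentIndex-suc {u} up)) (i≤i+j _ _)
  ... | inj₂ down = subst (ascentIndex u k ≤_) (sym (ascentIndex-suc {u} down)) (i≤i+j _ _)

  ascends⇒ascentIndex-ascends : ∀ {k} → Ascends u k → Ascends (ascentIndex u) k
  ascends⇒ascentIndex-ascends {k} asc with unitStep {u} unit k
  ... | inj₁ up   = subst (ascentIndex u k <_) (sym (ascentIndex-suc {u} up)) (i<i+j _ _)
  ... | inj₂ down = contradiction (i-j≤i (u k) 1ℤ) (<⇒≱ (subst (u k <_) down asc))

  ¬ascends⇒neg-ascends : ∀ {k} → ¬ Ascends u k → Ascends (λ k → - u k) k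
  ¬ascends⇒neg-ascends {k} ¬asc with unitStep {u} unit k
  ... | inj₁ up   = contradiction (subst (u k <_) (sym up) (i<i+j (u k) 1ℤ)) ¬asc
  ... | inj₂ down = subst (- u k <_) (sym (trans (cong -_ down) (neg-distrib-+ (u k) -1ℤ)))
                      (i<i+j (- u k) 1ℤ)

  ascentIndex-injective : ∀ {k l} → Ascends u k → Ascends u l →
                          ascentIndex u k ≡ ascentIndex u l → k ≡ l
  ascentIndex-injective asc-k asc-l = stepwiseMonotone-injective-on-ascents
    ascentIndex-stepwiseMonotone (ascends⇒ascentIndex-ascends asc-k) (ascends⇒ascentIndex-ascends asc-l)

-- descentIndex u is definitionally ascentIndex (-u), since i - j = i + - j.
descentIndex-injective : ∀ {u k l} → UnitSteps u → ¬ Ascends u k → ¬ Ascends u l →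
                         descentIndex u k ≡ descentIndex u l → k ≡ l
descentIndex-injective {u} unit ¬asc-k ¬asc-l = ascentIndex-injective (unitSteps-neg {u} unit)
  (¬ascends⇒neg-ascends {u} unit ¬asc-k) (¬ascends⇒neg-ascends {u} unit ¬asc-l)

index₁ index₂ : EdgeVar → ℤ
index₁ (a x _) = x
index₁ (b x _) = x
index₁ (c x _) = x
index₁ (d x _) = x
index₂ (a _ y) = y
index₂ (b _ y) = y
index₂ (c _ y) = y
index₂ (d _ y) = y

direction : EdgeVar → Dir
direction (a _ _) = horiz
direction (b _ _) = vert
direction (c _ _) = horiz
direction (d _ _) = vert

module _ (H : HeightFunction) where
  open HeightFunction H

  label-direction : ∀ e → direction (label H e) ≡ WEdge.dir e
  label-direction (wedge i j horiz) with h i j <? h (i + 1ℤ) j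
  ... | yes _ = refl
  ... | no  _ = refl
  label-direction (wedge i j vert) with h i j <? h i (j + 1ℤ)
  ... | yes _ = refl
  ... | no  _ = refl

  label-preserves-direction : ∀ e e′ → label H e ≡ label H e′ → WEdge.dir e ≡ WEdge.dir e′
  label-preserves-direction e e′ eq =
    trans (sym (label-direction e)) (trans (cong direction eq) (label-direction e′))

  horizontal-label-injective : ∀ {i j i′ j′} →
    label H (wedge i j horiz) ≡ label H (wedge i′ j′ horiz) → wedge i j horiz ≡ wedge i′ j′ horiz
  horizontal-label-injective {i} {j} {i′} {j′} eq
    with h i j <? h (i + 1ℤ) j | h i′ j′ <? h (i′ + 1ℤ) j′
  ... | yes asc | yes asc′ with refl ← cong index₂ eq =
    cong (λ k → wedge k j horiz) (ascentIndex-injective (λ k → adjᵢ k j) asc asc′ (cong index₁ eq))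
  ... | no ¬asc | no ¬asc′ with refl ← cong index₂ eq =
    cong (λ k → wedge k j horiz) (descentIndex-injective (λ k → adjᵢ k j) ¬asc ¬asc′ (cong index₁ eq))
  horizontal-label-injective () | yes _ | no _
  horizontal-label-injective () | no _ | yes _

  vertical-label-injective : ∀ {i j i′ j′} →
    label H (wedge i j vert) ≡ label H (wedge i′ j′ vert) → wedge i j vert ≡ wedge i′ j′ vert
  vertical-label-injective {i} {j} {i′} {j′} eq
    with h i j <? h i (j + 1ℤ) | h i′ j′ <? h i′ (j′ + 1ℤ)
  ... | yes asc | yes asc′ with refl ← cong index₁ eq =
    cong (λ k → wedge i k vert) (ascentIndex-injective (adjⱼ i) asc asc′ (cong index₂ eq))
  ... | no ¬asc | no ¬asc′ with refl ← cong index₁ eq =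
    cong (λ k → wedge i k vert) (descentIndex-injective (adjⱼ i) ¬asc ¬asc′ (cong index₂ eq))
  vertical-label-injective () | yes _ | no _
  vertical-label-injective () | no _ | yes _

mainTheorem3 : (H : HeightFunction) → (e e′ : WEdge) →
    label H e ≡ label H e′ → e ≡ e′
mainTheorem3 H (wedge _ _ horiz) (wedge _ _ horiz) = horizontal-label-injective H
mainTheorem3 H (wedge _ _ vert)  (wedge _ _ vert)  = vertical-label-injective H
mainTheorem3 H e@(wedge _ _ horiz) e′@(wedge _ _ vert) eq =
  contradiction (label-preserves-direction H e e′ eq) λ ()
mainTheorem3 H e@(wedge _ _ vert) e′@(wedge _ _ horiz) eq =
  contradiction (label-preserves-direction H e e′ eq) λ ()
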